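{- Let $n\ge2$ and $v\in A_{n+1}$. Then, under either convention (a) or (b) below, $\mathrm{del}_A(v)$ equals the number of almost-left-to-right minima of $v^{ -1}$. In particular $|\mathrm{Del}_A(v)|=\mathrm{del}_A(v)=\mathrm{del}_A(v^{ -1})$.
   Context: For $u=[b_1,\dots,b_{n+1}]\in S_{n+1}$ in one-line notation, a position $i$ is an almost-left-to-right minimum if $|\{1\le j\le i: b_j<b_i\}|\le1$ and additionally, under convention (a), $i\notin\{1,2\}$, or, under convention (b), $b_i\notin\{1,2\}$. $\mathrm{Del}_A(u)$ is the set of almost-left-to-right minima of $u$ under convention (a). Permutations are multiplied as functions; $s_i=(i,i+1)$; $a_i=s_1s_{i+1}$ ($1\le i\le n-1$); $R^A_j=\{1,a_j,a_ja_{j-1},\dots,a_j\cdots a_2,a_j\cdots a_2a_1,a_j\cdots a_2a_1^{ -1}\}$ (words; $R^A_1=\{1,a_1,a_1^{ -1}\}$). Every $v\in A_{n+1}$ factors uniquely as $v_1\cdots v_{n-1}$ with $v_j\in R^A_j$, and $\mathrm{del}_A(v)$ is the number of letters $a_1$ or $a_1^{ -1}$ in this word. -}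

module Defs where

open import Data.Nat using (ℕ; zero; suc; _+_; _∸_; _<_; _≤_; _<?_; _≤?_; _≡ᵇ_; pred; _%_)
open import Data.Bool using (Bool; true; false; if_then_else_; _∧_)
open import Data.Fin using (Fin; toℕ; fromℕ<)
open import Data.List using (List; []; _∷_; _++_; map; concat; upTo; allFin; length; filterᵇ)
open import Data.List.Membership.Propositional using (_∈_)
open import Data.Vec as Vec using (Vec; lookup; tabulate; toList)
open import Data.Fin.Subset using (Subset; inside; outside)
open import Data.Fin.Permutation using (Permutation′; _∘ₚ_; id; transpose; _⟨$⟩ʳ_)
open import Data.Product using (Σ)
open import Data.Nat.ListAction using (sum)
open import Relation.Nullary.Decidable using (⌊_⌋; yes; no)

-- Permutations of {1,…,m} are elements of  Permutation′ m  (acting on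
-- Fin m; the value k : Fin m stands for the integer k+1).
-- Product "as functions":  (u · v)(x) = u (v x).  (Note that the stdlib's
-- _∘ₚ_ is diagrammatic: (π₁ ∘ₚ π₂) applies π₁ first.)

infixl 7 _·_
_·_ : ∀ {m} → Permutation′ m → Permutation′ m → Permutation′ m
u · v = v ∘ₚ u

countFin : ∀ {m} → (Fin m → Bool) → ℕ
countFin {m} P = length (filterᵇ P (allFin m))

subsetOf : ∀ {m} → (Fin m → Bool) → Subset m
subsetOf P = tabulate (λ i → if P i then inside else outside)

inversions : ∀ {m} → Permutation′ m → ℕ
inversions {m} v =
  sum (map (λ i → countFin (λ j → ⌊ toℕ i <? toℕ j ⌋ ∧ ⌊ toℕ (v ⟨$⟩ʳ j) <? toℕ (v ⟨$⟩ʳ i) ⌋))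
           (allFin m))

IsEven : ∀ {m} → Permutation′ m → Set
IsEven v = inversions v % 2 ≡ 0
  where open import Relation.Binary.PropositionalEquality using (_≡_)

-- Simple transpositions  s_i = (i, i+1)  in S_{n+1}, for 1 ≤ i ≤ n.
-- (For an index outside this range we return the identity; this junk
-- value is never used in the statement, where all indices are in range.)

s : (n : ℕ) → ℕ → Permutation′ (suc n)
s n zero = id
s n (suc p) with suc p <? suc n
... | yes p+1<m = transpose (fromℕ< {p} (Data.Nat.Properties.<-trans (Data.Nat.Properties.n<1+n p) p+1<m))
                           (fromℕ< p+1<m)
  where import Data.Nat.Properties
... | no _ = id

-- Letters of words in the generators a_i^{±1}:
-- inverted = false means a_i, inverted = true means a_i^{-1}.
record Letter : Set where
  constructor letter
  field
    index    : ℕ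
    inverted : Bool
open Letter public

⟦_⟧ₗ : ∀ {n} → Letter → Permutation′ (suc n)
⟦_⟧ₗ {n} (letter i false) = s n 1 · s n (suc i)
⟦_⟧ₗ {n} (letter i true)  = s n (suc i) · s n 1

⟦_⟧ʷ : ∀ {n} → List Letter → Permutation′ (suc n)
⟦ [] ⟧ʷ     = id
⟦ l ∷ w ⟧ʷ  = ⟦ l ⟧ₗ · ⟦ w ⟧ʷ

desc : ℕ → ℕ → List Letter
desc j zero    = []
desc j (suc k) = letter j false ∷ desc (pred j) k

-- R^A_j = {1, a_j, a_j a_{j-1}, …, a_j⋯a_2, a_j⋯a_2 a_1, a_j⋯a_2 a_1^{-1}}
-- as a list of words.
RA : ℕ → List (List Letter)
RA j = map (desc j) (upTo (suc j)) ++ ((desc j (j ∸ 1) ++ (letter 1 true ∷ [])) ∷ [])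

-- A factorization v_1 ⋯ v_{n-1} with v_j ∈ R^A_j  (component number
-- t : Fin (n ∸ 1) is v_{t+1}).
record Factorization (n : ℕ) : Set where
  constructor factorization
  field
    factors  : Vec (List Letter) (n ∸ 1)
    inRA     : (t : Fin (n ∸ 1)) → lookup factors t ∈ RA (suc (toℕ t))
open Factorization public

word : ∀ {n} → Factorization n → List Letter
word f = concat (toList (factors f))

eval : ∀ {n} → Factorization n → Permutation′ (suc n)
eval {n} f = ⟦ word f ⟧ʷ

delA : ∀ {n} → Factorization n → ℕ
delA {n} f = length (filterᵇ (λ l → index l ≡ᵇ 1) (word f))

data Convention : Set where
  conv-a conv-b : Convention

smallerBefore : ∀ {m} → Permutation′ m → Fin m → ℕ
smallerBefore u i = countFin (λ j → ⌊ toℕ j ≤? toℕ i ⌋ ∧ ⌊ toℕ (u ⟨$⟩ʳ j) <? toℕ (u ⟨$⟩ʳ i) ⌋)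

-- position i (0-based index; paper position toℕ i + 1) is an
-- almost-left-to-right minimum of u under the given convention:
--   (a) position ∉ {1,2}, i.e. toℕ i ≥ 2;   (b) value b_i ∉ {1,2}.
isALRM : ∀ {m} → Convention → Permutation′ m → Fin m → Bool
isALRM conv-a u i = ⌊ smallerBefore u i ≤? 1 ⌋ ∧ ⌊ 2 ≤? toℕ i ⌋
isALRM conv-b u i = ⌊ smallerBefore u i ≤? 1 ⌋ ∧ ⌊ 2 ≤? toℕ (u ⟨$⟩ʳ i) ⌋

alrmCount : ∀ {m} → Convention → Permutation′ m → ℕ
alrmCount c u = countFin (isALRM c u)

DelA : ∀ {m} → Permutation′ m → Subset m
DelA u = subsetOf (isALRM conv-a u)

module Submission where

-- Model a permutation v of {0, …, m} by its sequence x ↦ v x on ℕ. In a factorization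
-- v = v_1 ⋯ v_{n−1} the factor v_{n−1} ∈ R^A_{n−1} acts first, and every element of R^A_j
-- sends one position p to the maximal value while keeping the other positions in order,
-- except that the first two are exchanged when an odd number of positions follow p. So the
-- sequence of v is that of v_1 ⋯ v_{n−2}, its first two entries possibly exchanged, with
-- the new maximum inserted at position p. The inserted maximum has at most one smaller
-- entry before it exactly when p ≤ 1, that is, when the factor contains a_1^{±1}, and the
-- exchange of the first two entries changes neither count; by induction del_A counts the
-- almost-left-to-right minima of v under both conventions. Inverting v exchanges positions
-- with values and hence the two conventions. The factorization exists because the same
-- recursion runs backwards on even permutations: remove the maximum, and exchange the first
-- two entries when that is needed to stay even.

open import Data.Bool using (Bool; true; false; not; _∧_; T)
open import Data.Bool.Properties using (not-involutive; ∧-zeroʳ; ∧-identityʳ; T-≡)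
open import Data.Fin as Fin using (Fin; toℕ; fromℕ<)
open import Data.Fin.Permutation as Perm using (Permutation′; _⟨$⟩ʳ_; _⟨$⟩ˡ_; flip; _≈_)
import Data.Fin.Permutation.Components as PC
open import Data.Fin.Properties using (toℕ-injective; toℕ-fromℕ<; fromℕ<-toℕ; toℕ<n)
open import Data.Fin.Subset using (∣_∣)
open import Data.List as List using (List; []; _∷_; _++_; length; filterᵇ; map; upTo)
open import Data.List.Membership.Propositional using (_∈_)
open import Data.List.Membership.Propositional.Properties
  using (∈-++⁻; ∈-++⁺ˡ; ∈-++⁺ʳ; ∈-map⁻; ∈-map⁺; ∈-upTo⁻; ∈-upTo⁺)
open import Data.List.Properties using (filter-++; length-++; map-tabulate; ++-identityʳ; ++-assoc)
open import Data.List.Relation.Unary.All as All using (All; []; _∷_)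
open import Data.List.Relation.Unary.All.Properties using (++⁺)
open import Data.List.Relation.Unary.Any using (here)
open import Data.Nat
  using (ℕ; zero; suc; pred; _+_; _∸_; _%_; _≡ᵇ_; _≤ᵇ_; _<ᵇ_; _≤_; _<_; _≰_; _≮_; z≤n; s≤s; _≤?_; _<?_)
open import Data.Nat.ListAction using (sum)
open import Data.Nat.Properties
open import Data.Product using (Σ; _×_; _,_)
open import Data.Sum using (inj₁; inj₂)
open import Data.Vec using (Vec; []; _∷_; _∷ʳ_; lookup; toList; initLast)
open import Function using (_∘_; Equivalence)
open import Relation.Binary.Definitions using (tri<; tri≈; tri>)
open import Relation.Binary.PropositionalEquality
open import Relation.Nullary using (contradiction; yes; no)
open import Relation.Nullary.Decidable using (⌊_⌋; T?; isYes≗does)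
import Algebra.Properties.CommutativeMonoid.Sum +-0-commutativeMonoid as FinSum
open import Algebra.Properties.CommutativeSemigroup +-commutativeSemigroup
  using (interchange; x∙yz≈y∙xz; x∙yz≈xz∙y; xy∙z≈xz∙y)

open import Defs

open ≡-Reasoning

-- Booleans, parity and sums over initial segments

iverson : Bool → ℕ
iverson true  = 1
iverson false = 0

≤ᵇ-true : ∀ {m n} → m ≤ n → (m ≤ᵇ n) ≡ true
≤ᵇ-true = Equivalence.to T-≡ ∘ ≤⇒≤ᵇ

≤ᵇ-false : ∀ {m n} → m ≰ n → (m ≤ᵇ n) ≡ false
≤ᵇ-false {m} {n} m≰n with m ≤ᵇ n in eq
... | true  = contradiction (≤ᵇ⇒≤ m n (subst T (sym eq) _)) m≰n
... | false = refl

<ᵇ-true : ∀ {m n} → m < n → (m <ᵇ n) ≡ true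
<ᵇ-true = ≤ᵇ-true

<ᵇ-false : ∀ {m n} → m ≮ n → (m <ᵇ n) ≡ false
<ᵇ-false = ≤ᵇ-false

≤ᵇ-<ᵇ-suc : ∀ m n → (m ≤ᵇ n) ≡ (m <ᵇ suc n)
≤ᵇ-<ᵇ-suc zero    n = refl
≤ᵇ-<ᵇ-suc (suc m) n = refl

≤ᵇ-<ᵇ-≢ : ∀ {m n} → m ≢ n → (m ≤ᵇ n) ≡ (m <ᵇ n)
≤ᵇ-<ᵇ-≢ {m} {n} m≢n with <-cmp m n
... | tri< m<n _ _ = trans (≤ᵇ-true (<⇒≤ m<n)) (sym (<ᵇ-true m<n))
... | tri≈ _ m≡n _ = contradiction m≡n m≢n
... | tri> _ _ n<m = trans (≤ᵇ-false (<⇒≱ n<m)) (sym (<ᵇ-false (<⇒≯ n<m)))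

⌊≤?⌋ : ∀ m n → ⌊ m ≤? n ⌋ ≡ (m ≤ᵇ n)
⌊≤?⌋ m n = isYes≗does (m ≤? n)

⌊<?⌋ : ∀ m n → ⌊ m <? n ⌋ ≡ (m <ᵇ n)
⌊<?⌋ m n = isYes≗does (m <? n)

parity : ℕ → Bool
parity zero    = false
parity (suc n) = not (parity n)

parity-+-suc : ∀ m n → parity (m + suc n) ≡ not (parity (m + n))
parity-+-suc m n = cong parity (+-suc m n)

%2≡0⇒parity≡false : ∀ n → n % 2 ≡ 0 → parity n ≡ false
%2≡0⇒parity≡false zero          _  = refl
%2≡0⇒parity≡false (suc zero)    ()
%2≡0⇒parity≡false (suc (suc n)) n%2≡0 = trans (not-involutive _) (%2≡0⇒parity≡false n n%2≡0)

∑< : ℕ → (ℕ → ℕ) → ℕ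
∑< zero    f = 0
∑< (suc m) f = f 0 + ∑< m (f ∘ suc)

syntax ∑< m (λ i → e) = ∑[ i < m ] e

∑-cong : ∀ m {f g : ℕ → ℕ} → (∀ i → i < m → f i ≡ g i) → ∑< m f ≡ ∑< m g
∑-cong zero    f≗g = refl
∑-cong (suc m) f≗g = cong₂ _+_ (f≗g 0 (s≤s z≤n)) (∑-cong m (λ i i<m → f≗g (suc i) (s≤s i<m)))

∑-zeros : ∀ m {f : ℕ → ℕ} → (∀ i → i < m → f i ≡ 0) → ∑< m f ≡ 0
∑-zeros zero    f≗0 = refl
∑-zeros (suc m) f≗0 rewrite f≗0 0 (s≤s z≤n) = ∑-zeros m (λ i i<m → f≗0 (suc i) (s≤s i<m))

∑-ones : ∀ m {f : ℕ → ℕ} → (∀ i → i < m → f i ≡ 1) → ∑< m f ≡ m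
∑-ones zero    f≗1 = refl
∑-ones (suc m) f≗1 rewrite f≗1 0 (s≤s z≤n) = cong suc (∑-ones m (λ i i<m → f≗1 (suc i) (s≤s i<m)))

∑-+ : ∀ a b (f : ℕ → ℕ) → ∑< (a + b) f ≡ ∑< a f + ∑[ i < b ] f (a + i)
∑-+ zero    b f = refl
∑-+ (suc a) b f rewrite ∑-+ a b (f ∘ suc) = sym (+-assoc (f 0) _ _)

∑-last : ∀ m (f : ℕ → ℕ) → ∑< (suc m) f ≡ ∑< m f + f m
∑-last zero    f = +-comm (f 0) 0
∑-last (suc m) f rewrite ∑-last m (f ∘ suc) = sym (+-assoc (f 0) _ _)

∑-distrib-+ : ∀ m (f g : ℕ → ℕ) → ∑[ i < m ] (f i + g i) ≡ ∑< m f + ∑< m g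
∑-distrib-+ zero    f g = refl
∑-distrib-+ (suc m) f g rewrite ∑-distrib-+ m (f ∘ suc) (g ∘ suc) = interchange (f 0) (g 0) _ _

∑-comm : ∀ m n (f : ℕ → ℕ → ℕ) → ∑[ i < m ] ∑[ j < n ] f i j ≡ ∑[ j < n ] ∑[ i < m ] f i j
∑-comm zero    n f = sym (∑-zeros n (λ _ _ → refl))
∑-comm (suc m) n f = begin
  ∑[ j < n ] f 0 j + ∑[ i < m ] ∑[ j < n ] f (suc i) j  ≡⟨ cong (∑[ j < n ] f 0 j +_) (∑-comm m n (f ∘ suc)) ⟩
  ∑[ j < n ] f 0 j + ∑[ j < n ] ∑[ i < m ] f (suc i) j  ≡⟨ ∑-distrib-+ n (f 0) _ ⟨
  ∑[ j < n ] (f 0 j + ∑[ i < m ] f (suc i) j)           ∎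

∑-below : ∀ M x (b : ℕ → Bool) → x ≤ M → ∑[ y < M ] iverson ((y <ᵇ x) ∧ b y) ≡ ∑[ y < x ] iverson (b y)
∑-below M       zero    b _         = ∑-zeros M (λ _ _ → refl)
∑-below (suc M) (suc x) b (s≤s x≤M) = cong (iverson (b 0) +_) (∑-below M x (b ∘ suc) x≤M)

-- Statistics of sequences and insertion of a maximum

countBefore : (ℕ → ℕ → ℕ) → (ℕ → ℕ) → ℕ → ℕ
countBefore ρ g x = ∑[ y < x ] ρ (g y) (g x)

statistic : (ℕ → ℕ → ℕ) → (ℕ → ℕ → ℕ) → ℕ → (ℕ → ℕ) → ℕ
statistic ρ φ M g = ∑[ x < M ] φ (countBefore ρ g x) (g x)

statistic-cong : ∀ ρ φ M {g h : ℕ → ℕ} → (∀ x → x < M → g x ≡ h x) → statistic ρ φ M g ≡ statistic ρ φ M h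
statistic-cong ρ φ M g≗h = ∑-cong M (λ x x<M → cong₂ φ
  (∑-cong x (λ y y<x → cong₂ ρ (g≗h y (<-trans y<x x<M)) (g≗h x x<M))) (g≗h x x<M))

Bounded : ℕ → (ℕ → ℕ) → Set
Bounded m U = ∀ x → x < m → U x < m

record MaxInserted (p r : ℕ) (U V : ℕ → ℕ) : Set where
  field
    before : ∀ x → x < p → V x ≡ U x
    at     : V p ≡ p + r
    after  : ∀ t → t < r → V (suc (p + t)) ≡ U (p + t)
open MaxInserted public

maxInserted-∘ : ∀ {p r U V} (g : ℕ → ℕ) → MaxInserted p r U V → g (p + r) ≡ p + r →
  MaxInserted p r (g ∘ U) (g ∘ V)
maxInserted-∘ g ins g-fixes = record
  { before = λ x x<p → cong g (before ins x x<p)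
  ; at     = trans (cong g (at ins)) g-fixes
  ; after  = λ t t<r → cong g (after ins t t<r)
  }

maxInserted-unique : ∀ {p r U₁ V₁ U₂ V₂} → MaxInserted p r U₁ V₁ → MaxInserted p r U₂ V₂ →
  (∀ x → x < p + r → U₁ x ≡ U₂ x) → ∀ x → x < suc (p + r) → V₁ x ≡ V₂ x
maxInserted-unique {p} {r} ins₁ ins₂ U₁≗U₂ x x<1+p+r with <-cmp x p
... | tri< x<p _ _  = trans (before ins₁ x x<p)
                        (trans (U₁≗U₂ x (<-≤-trans x<p (m≤m+n p r))) (sym (before ins₂ x x<p)))
... | tri≈ _ refl _ = trans (at ins₁) (sym (at ins₂))
... | tri> _ _ (s≤s {n = y} p≤y) rewrite sym (m+[n∸m]≡n p≤y) =
  trans (after ins₁ t t<r) (trans (U₁≗U₂ (p + t) (+-monoʳ-< p t<r)) (sym (after ins₂ t t<r)))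
  where
  t : ℕ
  t = y ∸ p
  t<r : t < r
  t<r = +-cancelˡ-< p t r (≤-pred x<1+p+r)

module _ (ρ : ℕ → ℕ → ℕ) {p r : ℕ} {U V : ℕ → ℕ} (ins : MaxInserted p r U V) where

  countBefore-before : ∀ x → x < p → countBefore ρ V x ≡ countBefore ρ U x
  countBefore-before x x<p rewrite before ins x x<p =
    ∑-cong x (λ y y<x → cong (λ z → ρ z (U x)) (before ins y (<-trans y<x x<p)))

  countBefore-at : countBefore ρ V p ≡ ∑[ y < p ] ρ (U y) (p + r)
  countBefore-at rewrite at ins = ∑-cong p (λ y y<p → cong (λ z → ρ z (p + r)) (before ins y y<p))

  countBefore-after : ∀ t → t < r →
    countBefore ρ V (suc (p + t)) ≡ countBefore ρ U (p + t) + ρ (p + r) (U (p + t))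
  countBefore-after t t<r rewrite after ins t t<r = begin
    ∑< (suc (p + t)) (λ y → ρ (V y) c)                                  ≡⟨ cong (λ z → ∑< z (λ y → ρ (V y) c)) (+-suc p t) ⟨
    ∑< (p + suc t) (λ y → ρ (V y) c)                                    ≡⟨ ∑-+ p (suc t) _ ⟩
    ∑[ y < p ] ρ (V y) c + (ρ (V (p + 0)) c + ∑[ i < t ] ρ (V (p + suc i)) c)
      ≡⟨ cong₂ (λ a b → a + (ρ b c + ∑[ i < t ] ρ (V (p + suc i)) c)) before′ (trans (cong V (+-identityʳ p)) (at ins)) ⟩
    ∑[ y < p ] ρ (U y) c + (ρ (p + r) c + ∑[ i < t ] ρ (V (p + suc i)) c)
      ≡⟨ cong (λ z → ∑[ y < p ] ρ (U y) c + (ρ (p + r) c + z)) after′ ⟩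
    a + (b + d)                                                         ≡⟨ x∙yz≈xz∙y a b d ⟩
    a + d + b                                                           ≡⟨ cong (_+ b) (∑-+ p t _) ⟨
    ∑< (p + t) (λ y → ρ (U y) c) + ρ (p + r) c                          ∎
    where
    c a b d : ℕ
    c = U (p + t)
    a = ∑[ y < p ] ρ (U y) c
    b = ρ (p + r) c
    d = ∑[ i < t ] ρ (U (p + i)) c
    before′ : ∑[ y < p ] ρ (V y) c ≡ ∑[ y < p ] ρ (U y) c
    before′ = ∑-cong p (λ y y<p → cong (λ z → ρ z c) (before ins y y<p))
    after′ : ∑[ i < t ] ρ (V (p + suc i)) c ≡ ∑[ i < t ] ρ (U (p + i)) c
    after′ = ∑-cong t (λ i i<t → cong (λ z → ρ z c) (trans (cong V (+-suc p i)) (after ins i (<-trans i<t t<r))))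

  statistic-insert : ∀ φ → statistic ρ φ (suc (p + r)) V ≡
    ∑[ x < p ] φ (countBefore ρ U x) (U x) + φ (∑[ y < p ] ρ (U y) (p + r)) (p + r)
      + ∑[ t < r ] φ (countBefore ρ U (p + t) + ρ (p + r) (U (p + t))) (U (p + t))
  statistic-insert φ = begin
    ∑< (suc (p + r)) F                            ≡⟨ cong (λ z → ∑< z F) (+-suc p r) ⟨
    ∑< (p + suc r) F                              ≡⟨ ∑-+ p (suc r) F ⟩
    ∑< p F + (F (p + 0) + ∑[ i < r ] F (p + suc i))
      ≡⟨ cong₂ _+_ (∑-cong p (λ x x<p → cong₂ φ (countBefore-before x x<p) (before ins x x<p)))
                   (cong₂ _+_ (trans (cong F (+-identityʳ p)) (cong₂ φ countBefore-at (at ins)))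
                              (∑-cong r (λ i i<r → trans (cong F (+-suc p i))
                                 (cong₂ φ (countBefore-after i i<r) (after ins i i<r))))) ⟩
    A + (B + C)                                   ≡⟨ +-assoc A B C ⟨
    A + B + C                                     ∎
    where
    F : ℕ → ℕ
    F x = φ (countBefore ρ V x) (V x)
    A B C : ℕ
    A = ∑[ x < p ] φ (countBefore ρ U x) (U x)
    B = φ (∑[ y < p ] ρ (U y) (p + r)) (p + r)
    C = ∑[ t < r ] φ (countBefore ρ U (p + t) + ρ (p + r) (U (p + t))) (U (p + t))

smaller larger : ℕ → ℕ → ℕ
smaller a b = iverson (a <ᵇ b)
larger  a b = iverson (b <ᵇ a)

-- Convention (a) excludes positions rather than values, so it is no statistic; fewSmaller
-- drops the exclusion, which only adds the first two positions.
fewSmaller fewSmallerᵇ : ℕ → ℕ → ℕ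
fewSmaller  s v = iverson (s ≤ᵇ 1)
fewSmallerᵇ s v = iverson ((s ≤ᵇ 1) ∧ (2 ≤ᵇ v))

inversionCount : ℕ → (ℕ → ℕ) → ℕ
inversionCount = statistic larger (λ s _ → s)

alrmCountᵃ : ℕ → (ℕ → ℕ) → ℕ
alrmCountᵃ M g = ∑[ x < M ] iverson ((countBefore smaller g x ≤ᵇ 1) ∧ (2 ≤ᵇ x))

module _ {p r : ℕ} {U V : ℕ → ℕ} (ins : MaxInserted p r U V) (U<p+r : Bounded (p + r) U) where

  statistic-smaller-insert : ∀ φ →
    statistic smaller φ (suc (p + r)) V ≡ statistic smaller φ (p + r) U + φ p (p + r)
  statistic-smaller-insert φ = begin
    statistic smaller φ (suc (p + r)) V                                  ≡⟨ statistic-insert smaller ins φ ⟩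
    ∑< p F + φ (∑[ y < p ] smaller (U y) (p + r)) (p + r)
      + ∑[ t < r ] φ (countBefore smaller U (p + t) + smaller (p + r) (U (p + t))) (U (p + t))
      ≡⟨ cong₂ (λ a b → ∑< p F + φ a (p + r) + b) all-smaller none-larger-after ⟩
    ∑< p F + φ p (p + r) + ∑[ t < r ] F (p + t)                    ≡⟨ xy∙z≈xz∙y (∑< p F) (φ p (p + r)) _ ⟩
    ∑< p F + ∑[ t < r ] F (p + t) + φ p (p + r)                    ≡⟨ cong (_+ φ p (p + r)) (∑-+ p r F) ⟨
    statistic smaller φ (p + r) U + φ p (p + r)                          ∎
    where
    F : ℕ → ℕ
    F x = φ (countBefore smaller U x) (U x)
    all-smaller : ∑[ y < p ] smaller (U y) (p + r) ≡ p
    all-smaller = ∑-ones p (λ y y<p → cong iverson (≤ᵇ-true (U<p+r y (≤-trans y<p (m≤m+n p r)))))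
    none-larger-after : ∑[ t < r ] φ (countBefore smaller U (p + t) + smaller (p + r) (U (p + t))) (U (p + t))
                      ≡ ∑[ t < r ] F (p + t)
    none-larger-after = ∑-cong r (λ t t<r → cong (λ z → φ z (U (p + t)))
      (trans (cong (λ b → countBefore smaller U (p + t) + iverson b)
                   (≤ᵇ-false (<⇒≯ (U<p+r (p + t) (+-monoʳ-< p t<r)))))
             (+-identityʳ _)))

  inversionCount-insert : inversionCount (suc (p + r)) V ≡ inversionCount (p + r) U + r
  inversionCount-insert = begin
    inversionCount (suc (p + r)) V                                       ≡⟨ statistic-insert larger ins (λ s _ → s) ⟩
    ∑< p G + ∑[ y < p ] larger (U y) (p + r) + ∑[ t < r ] (G (p + t) + larger (p + r) (U (p + t)))
      ≡⟨ cong₂ (λ a b → ∑< p G + a + b) none-larger all-larger-after ⟩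
    ∑< p G + 0 + ∑[ t < r ] (G (p + t) + 1)                             ≡⟨ cong₂ _+_ (+-identityʳ (∑< p G)) (∑-distrib-+ r _ _) ⟩
    ∑< p G + (∑[ t < r ] G (p + t) + ∑[ t < r ] 1)                       ≡⟨ cong (λ z → ∑< p G + (∑[ t < r ] G (p + t) + z)) (∑-ones r (λ _ _ → refl)) ⟩
    ∑< p G + (∑[ t < r ] G (p + t) + r)                                  ≡⟨ +-assoc (∑< p G) _ r ⟨
    ∑< p G + ∑[ t < r ] G (p + t) + r                                    ≡⟨ cong (_+ r) (∑-+ p r G) ⟨
    inversionCount (p + r) U + r                                         ∎
    where
    G : ℕ → ℕ
    G = countBefore larger U
    none-larger : ∑[ y < p ] larger (U y) (p + r) ≡ 0
    none-larger = ∑-zeros p (λ y y<p → cong iverson (≤ᵇ-false (<⇒≯ (U<p+r y (≤-trans y<p (m≤m+n p r))))))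
    all-larger-after : ∑[ t < r ] (G (p + t) + larger (p + r) (U (p + t))) ≡ ∑[ t < r ] (G (p + t) + 1)
    all-larger-after = ∑-cong r (λ t t<r →
      cong (λ b → G (p + t) + iverson b) (≤ᵇ-true (U<p+r (p + t) (+-monoʳ-< p t<r))))

iverson-≤ᵇ-1 : ∀ b → (iverson b + 0 ≤ᵇ 1) ≡ true
iverson-≤ᵇ-1 true  = refl
iverson-≤ᵇ-1 false = refl

alrmCountᵃ-fewSmaller : ∀ r g → alrmCountᵃ (2 + r) g + 2 ≡ statistic smaller fewSmaller (2 + r) g
alrmCountᵃ-fewSmaller r g
  rewrite ∧-zeroʳ (countBefore smaller g 1 ≤ᵇ 1)
        | ∑-cong r {λ t → iverson ((countBefore smaller g (2 + t) ≤ᵇ 1) ∧ true)}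
                   {λ t → iverson (countBefore smaller g (2 + t) ≤ᵇ 1)}
                   (λ t _ → cong iverson (∧-identityʳ _))
        | iverson-≤ᵇ-1 (g 0 <ᵇ g 1)
  = +-comm _ 2

-- Swaps of adjacent values

-- swapAdj i is s_{i+1} on the 0-based values; swap01 is s_1.
swapAdj : ℕ → ℕ → ℕ
swapAdj zero    zero          = 1
swapAdj zero    (suc zero)    = 0
swapAdj zero    (suc (suc x)) = suc (suc x)
swapAdj (suc i) zero          = zero
swapAdj (suc i) (suc x)       = suc (swapAdj i x)

swapAdj-self : ∀ i → swapAdj i i ≡ suc i
swapAdj-self zero    = refl
swapAdj-self (suc i) = cong suc (swapAdj-self i)

swapAdj-suc : ∀ i → swapAdj i (suc i) ≡ i
swapAdj-suc zero    = refl
swapAdj-suc (suc i) = cong suc (swapAdj-suc i)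

swapAdj-≢ : ∀ i x → x ≢ i → x ≢ suc i → swapAdj i x ≡ x
swapAdj-≢ zero    zero          x≢i _     = contradiction refl x≢i
swapAdj-≢ zero    (suc zero)    _   x≢1+i = contradiction refl x≢1+i
swapAdj-≢ zero    (suc (suc x)) _   _     = refl
swapAdj-≢ (suc i) zero          _   _     = refl
swapAdj-≢ (suc i) (suc x)       x≢i x≢1+i = cong suc (swapAdj-≢ i x (x≢i ∘ cong suc) (x≢1+i ∘ cong suc))

swapAdj-< : ∀ {i x} → x < i → swapAdj i x ≡ x
swapAdj-< x<i = swapAdj-≢ _ _ (<⇒≢ x<i) (<⇒≢ (m<n⇒m<1+n x<i))

swapAdj-> : ∀ {i x} → suc i < x → swapAdj i x ≡ x
swapAdj-> i+1<x = swapAdj-≢ _ _ (>⇒≢ (<-trans (n<1+n _) i+1<x)) (>⇒≢ i+1<x)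

swapAdj-bounded : ∀ {B} i x → i < B → x < suc B → swapAdj i x < suc B
swapAdj-bounded zero    zero          i<B _         = s≤s i<B
swapAdj-bounded zero    (suc zero)    _   _         = s≤s z≤n
swapAdj-bounded zero    (suc (suc x)) _   x<1+B     = x<1+B
swapAdj-bounded (suc i) zero          _   x<1+B     = x<1+B
swapAdj-bounded {suc B} (suc i) (suc x) (s≤s i<B) (s≤s x<1+B) = s≤s (swapAdj-bounded i x i<B x<1+B)

swap01 : ℕ → ℕ
swap01 = swapAdj 0

swap01-involutive : ∀ x → swap01 (swap01 x) ≡ x
swap01-involutive zero          = refl
swap01-involutive (suc zero)    = refl
swap01-involutive (suc (suc x)) = refl

swapIfOdd : ℕ → ℕ → ℕ
swapIfOdd zero          x = x
swapIfOdd (suc zero)    x = swap01 x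
swapIfOdd (suc (suc k)) x = swapIfOdd k x

swapIfOdd-involutive : ∀ k x → swapIfOdd k (swapIfOdd k x) ≡ x
swapIfOdd-involutive zero          x = refl
swapIfOdd-involutive (suc zero)    x = swap01-involutive x
swapIfOdd-involutive (suc (suc k)) x = swapIfOdd-involutive k x

swapIfOdd-≥2 : ∀ k {x} → 2 ≤ x → swapIfOdd k x ≡ x
swapIfOdd-≥2 zero          _   = refl
swapIfOdd-≥2 (suc zero)    2≤x = swapAdj-> 2≤x
swapIfOdd-≥2 (suc (suc k)) 2≤x = swapIfOdd-≥2 k 2≤x

swapIfOdd-bounded : ∀ k {m x} → (0 < k → 2 ≤ m) → x < m → swapIfOdd k x < m
swapIfOdd-bounded zero          _    x<m = x<m
swapIfOdd-bounded (suc zero)    2≤m x<m with 2≤m (s≤s z≤n)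
... | s≤s 1≤B = swapAdj-bounded 0 _ 1≤B x<m
swapIfOdd-bounded (suc (suc k)) 2≤m x<m = swapIfOdd-bounded k (λ _ → 2≤m (s≤s z≤n)) x<m

swap01-swapIfOdd : ∀ k x → swap01 (swapIfOdd k x) ≡ swapIfOdd (suc k) x
swap01-swapIfOdd zero          x = refl
swap01-swapIfOdd (suc zero)    x = swap01-involutive x
swap01-swapIfOdd (suc (suc k)) x = swap01-swapIfOdd k x

statistic-swap01 : ∀ ρ φ r (g : ℕ → ℕ) →
  statistic ρ φ (2 + r) (g ∘ swap01) ≡
    φ 0 (g 1) + (φ (ρ (g 1) (g 0) + 0) (g 0) + ∑[ t < r ] φ (countBefore ρ g (2 + t)) (g (2 + t)))
statistic-swap01 ρ φ r g = cong (λ z → φ 0 (g 1) + (φ (ρ (g 1) (g 0) + 0) (g 0) + z))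
  (∑-cong r (λ t _ → cong (λ z → φ z (g (2 + t))) (x∙yz≈y∙xz (ρ (g 1) _) (ρ (g 0) _) _)))

statistic-smaller-swap01 : ∀ φ → (∀ v → φ 1 v ≡ φ 0 v) → ∀ r (g : ℕ → ℕ) →
  statistic smaller φ (2 + r) (g ∘ swap01) ≡ statistic smaller φ (2 + r) g
statistic-smaller-swap01 φ φ1≗φ0 r g = begin
  statistic smaller φ (2 + r) (g ∘ swap01)               ≡⟨ statistic-swap01 smaller φ r g ⟩
  φ 0 (g 1) + (φ (smaller (g 1) (g 0) + 0) (g 0) + X)   ≡⟨ cong (λ z → φ 0 (g 1) + (z + X)) (φ-bit (g 1 <ᵇ g 0) (g 0)) ⟩
  φ 0 (g 1) + (φ 0 (g 0) + X)                            ≡⟨ x∙yz≈y∙xz (φ 0 (g 1)) (φ 0 (g 0)) X ⟩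
  φ 0 (g 0) + (φ 0 (g 1) + X)                            ≡⟨ cong (λ z → φ 0 (g 0) + (z + X)) (φ-bit (g 0 <ᵇ g 1) (g 1)) ⟨
  statistic smaller φ (2 + r) g                          ∎
  where
  X : ℕ
  X = ∑[ t < r ] φ (countBefore smaller g (2 + t)) (g (2 + t))
  φ-bit : ∀ b v → φ (iverson b + 0) v ≡ φ 0 v
  φ-bit true  v = φ1≗φ0 v
  φ-bit false v = refl

statistic-smaller-swapIfOdd : ∀ φ → (∀ v → φ 1 v ≡ φ 0 v) → ∀ k r (g : ℕ → ℕ) →
  statistic smaller φ (2 + r) (g ∘ swapIfOdd k) ≡ statistic smaller φ (2 + r) g
statistic-smaller-swapIfOdd φ φ1≗φ0 zero          r g = refl
statistic-smaller-swapIfOdd φ φ1≗φ0 (suc zero)    r g = statistic-smaller-swap01 φ φ1≗φ0 r g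
statistic-smaller-swapIfOdd φ φ1≗φ0 (suc (suc k)) r g = statistic-smaller-swapIfOdd φ φ1≗φ0 k r g

inversionCount-swap01 : ∀ r (g : ℕ → ℕ) → g 0 ≢ g 1 →
  parity (inversionCount (2 + r) (g ∘ swap01)) ≡ not (parity (inversionCount (2 + r) g))
inversionCount-swap01 r g g0≢g1 rewrite statistic-swap01 larger (λ s _ → s) r g with <-cmp (g 0) (g 1)
... | tri< g0<g1 _ _ rewrite <ᵇ-true g0<g1 | <ᵇ-false (<⇒≯ g0<g1) = refl
... | tri≈ _ g0≡g1 _ = contradiction g0≡g1 g0≢g1
... | tri> _ _ g1<g0 rewrite <ᵇ-true g1<g0 | <ᵇ-false (<⇒≯ g1<g0) = sym (not-involutive _)

inversionCount-swapIfOdd : ∀ k r (g : ℕ → ℕ) → g 0 ≢ g 1 →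
  parity (inversionCount (2 + r) (g ∘ swapIfOdd k)) ≡ parity (inversionCount (2 + r) g + k)
inversionCount-swapIfOdd zero          r g _      = cong parity (sym (+-identityʳ (inversionCount (2 + r) g)))
inversionCount-swapIfOdd (suc zero)    r g g0≢g1 =
  trans (inversionCount-swap01 r g g0≢g1)
        (sym (trans (parity-+-suc I 0) (cong (not ∘ parity) (+-identityʳ I))))
  where I = inversionCount (2 + r) g
inversionCount-swapIfOdd (suc (suc k)) r g g0≢g1 = begin
  parity (inversionCount (2 + r) (g ∘ swapIfOdd k))  ≡⟨ inversionCount-swapIfOdd k r g g0≢g1 ⟩
  parity (I + k)                                     ≡⟨ not-involutive _ ⟨
  not (not (parity (I + k)))                         ≡⟨ cong not (parity-+-suc I k) ⟨
  not (parity (I + suc k))                           ≡⟨ parity-+-suc I (suc k) ⟨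
  parity (I + suc (suc k))                           ∎
  where
  I : ℕ
  I = inversionCount (2 + r) g

-- Words in the generators acting on ℕ

⟪_⟫ₗ : Letter → ℕ → ℕ
⟪ letter i false ⟫ₗ x = swap01 (swapAdj i x)
⟪ letter i true  ⟫ₗ x = swapAdj i (swap01 x)

⟪_⟫ʷ : List Letter → ℕ → ℕ
⟪ []    ⟫ʷ x = x
⟪ l ∷ w ⟫ʷ x = ⟪ l ⟫ₗ (⟪ w ⟫ʷ x)

⟪⟫ʷ-++ : ∀ u w x → ⟪ u ++ w ⟫ʷ x ≡ ⟪ u ⟫ʷ (⟪ w ⟫ʷ x)
⟪⟫ʷ-++ []      w x = refl
⟪⟫ʷ-++ (l ∷ u) w x = cong ⟪ l ⟫ₗ (⟪⟫ʷ-++ u w x)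

IndicesBelow : ℕ → List Letter → Set
IndicesBelow B = All (λ l → index l < B)

module _ {B : ℕ} where

  ⟪⟫ₗ-fixes : ∀ l → index l < B → ∀ y → B < y → ⟪ l ⟫ₗ y ≡ y
  ⟪⟫ₗ-fixes (letter i false) i<B y B<y rewrite swapAdj-> (<-≤-trans (s≤s i<B) B<y) =
    swapAdj-> (≤-trans (s≤s (≤-trans (s≤s z≤n) i<B)) B<y)
  ⟪⟫ₗ-fixes (letter i true)  i<B y B<y rewrite swapAdj-> (≤-trans (s≤s (≤-trans (s≤s z≤n) i<B)) B<y) =
    swapAdj-> (<-≤-trans (s≤s i<B) B<y)

  ⟪⟫ʷ-fixes : ∀ w → IndicesBelow B w → ∀ y → B < y → ⟪ w ⟫ʷ y ≡ y
  ⟪⟫ʷ-fixes []      []           y B<y = refl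
  ⟪⟫ʷ-fixes (l ∷ w) (l<B ∷ w<B) y B<y rewrite ⟪⟫ʷ-fixes w w<B y B<y = ⟪⟫ₗ-fixes l l<B y B<y

  ⟪⟫ₗ-bounded : ∀ l → index l < B → Bounded (suc B) ⟪ l ⟫ₗ
  ⟪⟫ₗ-bounded (letter i false) i<B x x<1+B =
    swapAdj-bounded 0 _ (≤-trans (s≤s z≤n) i<B) (swapAdj-bounded i x i<B x<1+B)
  ⟪⟫ₗ-bounded (letter i true)  i<B x x<1+B =
    swapAdj-bounded i _ i<B (swapAdj-bounded 0 x (≤-trans (s≤s z≤n) i<B) x<1+B)

  ⟪⟫ʷ-bounded : ∀ w → IndicesBelow B w → Bounded (suc B) ⟪ w ⟫ʷ
  ⟪⟫ʷ-bounded []      []           x x<1+B = x<1+B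
  ⟪⟫ʷ-bounded (l ∷ w) (l<B ∷ w<B) x x<1+B = ⟪⟫ₗ-bounded l l<B _ (⟪⟫ʷ-bounded w w<B x x<1+B)

desc-indicesBelow : ∀ {B} j k → j < B → IndicesBelow B (desc j k)
desc-indicesBelow j zero    j<B = []
desc-indicesBelow j (suc k) j<B = j<B ∷ desc-indicesBelow (pred j) k (≤-<-trans pred[n]≤n j<B)

countA₁ : List Letter → ℕ
countA₁ = length ∘ filterᵇ (λ l → index l ≡ᵇ 1)

countA₁-++ : ∀ u w → countA₁ (u ++ w) ≡ countA₁ u + countA₁ w
countA₁-++ u w = trans (cong length (filter-++ (T? ∘ (λ l → index l ≡ᵇ 1)) u w)) (length-++ (filterᵇ _ u))

countA₁-desc-above : ∀ j k → k < j → countA₁ (desc j k) ≡ 0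
countA₁-desc-above j             zero    _             = refl
countA₁-desc-above (suc (suc j)) (suc k) (s≤s k<1+j) = countA₁-desc-above (suc j) k k<1+j
countA₁-desc-above (suc zero)    (suc k) (s≤s ())

countA₁-desc-full : ∀ j → countA₁ (desc (suc j) (suc j)) ≡ 1
countA₁-desc-full zero    = refl
countA₁-desc-full (suc j) = countA₁-desc-full j

swap01-last : ∀ j k p → suc j ≡ p + k → 0 < p → swap01 (suc j) ≡ swapIfOdd (suc k) (suc j)
swap01-last (suc j) k p             _ _ = trans (swapAdj-> {0} (s≤s (s≤s z≤n))) (sym (swapIfOdd-≥2 (suc k) (s≤s (s≤s z≤n))))
swap01-last zero    zero    (suc zero)    _  _ = refl
swap01-last zero    zero    (suc (suc p)) () _
swap01-last zero    (suc k) (suc zero)    () _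
swap01-last zero    (suc k) (suc (suc p)) () _

-- Prepending a_{j+1} = s_1 s_{j+2} acts on the values: s_{j+2} lifts the inserted maximum
-- to j + 2, and s_1 exchanges 0 and 1 once more.
desc-maxInserted : ∀ k j p → suc j ≡ p + k → 0 < p → MaxInserted p k (swapIfOdd k) ⟪ desc j k ⟫ʷ
desc-maxInserted zero    j       p _ _ =
  record { before = λ _ _ → refl ; at = sym (+-identityʳ p) ; after = λ _ () }
desc-maxInserted (suc k) zero    (suc zero)    () _
desc-maxInserted (suc k) zero    (suc (suc p)) () _
desc-maxInserted (suc k) (suc j) p       e 0<p = record { before = before′ ; at = at′ ; after = after′ }
  where
  e′ : suc j ≡ p + k
  e′ = suc-injective (trans e (+-suc p k))
  ins : MaxInserted p k (swapIfOdd k) ⟪ desc j k ⟫ʷ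
  ins = desc-maxInserted k j p e′ 0<p
  R : ℕ → ℕ
  R = ⟪ desc j k ⟫ʷ
  aⱼ₊₁ : ℕ → ℕ
  aⱼ₊₁ = ⟪ letter (suc j) false ⟫ₗ
  aⱼ₊₁-swapIfOdd : ∀ x → x < suc j → aⱼ₊₁ (swapIfOdd k x) ≡ swapIfOdd (suc k) x
  aⱼ₊₁-swapIfOdd x x<1+j = trans (cong swap01 (swapAdj-< (swapIfOdd-bounded k 2≤1+j x<1+j))) (swap01-swapIfOdd k x)
    where
    2≤1+j : 0 < k → 2 ≤ suc j
    2≤1+j 0<k = subst (2 ≤_) (sym e′) (+-mono-≤ 0<p 0<k)
  before′ : ∀ x → x < p → aⱼ₊₁ (R x) ≡ swapIfOdd (suc k) x
  before′ x x<p rewrite before ins x x<p = aⱼ₊₁-swapIfOdd x (subst (x <_) (sym e′) (≤-trans x<p (m≤m+n p k)))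
  at′ : aⱼ₊₁ (R p) ≡ p + suc k
  at′ rewrite at ins | sym e′ | swapAdj-self (suc j) = e
  last : aⱼ₊₁ (R (suc (p + k))) ≡ swapIfOdd (suc k) (p + k)
  last rewrite sym e′ | ⟪⟫ʷ-fixes (desc j k) (desc-indicesBelow j k ≤-refl) (suc (suc j)) ≤-refl
             | swapAdj-suc (suc j) = swap01-last j k p e′ 0<p
  after′ : ∀ t → t < suc k → aⱼ₊₁ (R (suc (p + t))) ≡ swapIfOdd (suc k) (p + t)
  after′ t (s≤s t≤k) with m≤n⇒m<n∨m≡n t≤k
  ... | inj₁ t<k rewrite after ins t t<k = aⱼ₊₁-swapIfOdd (p + t) (subst (p + t <_) (sym e′) (+-monoʳ-< p t<k))
  ... | inj₂ refl = last

-- The element of R^A_{i+1} sending position p ≤ i + 2 to the maximum i + 2: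
-- a_{i+1} ⋯ a_2 a_1⁻¹ for p = 0 and a_{i+1} ⋯ a_{q+1} for p = q + 1.
raFactor : ℕ → ℕ → List Letter
raFactor i zero    = desc (suc i) i ++ letter 1 true ∷ []
raFactor i (suc q) = desc (suc i) (suc i ∸ q)

raFactor-∈RA : ∀ i p → raFactor i p ∈ RA (suc i)
raFactor-∈RA i zero    = ∈-++⁺ʳ (map (desc (suc i)) (upTo (suc (suc i)))) (here refl)
raFactor-∈RA i (suc q) = ∈-++⁺ˡ (∈-map⁺ (desc (suc i)) (∈-upTo⁺ (s≤s (m∸n≤m (suc i) q))))

∈RA⇒raFactor : ∀ i {w} → w ∈ RA (suc i) → Σ ℕ λ p → p ≤ 2 + i × w ≡ raFactor i p
∈RA⇒raFactor i w∈ with ∈-++⁻ (map (desc (suc i)) (upTo (suc (suc i)))) w∈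
... | inj₂ (here refl) = 0 , z≤n , refl
... | inj₁ w∈descs with ∈-map⁻ (desc (suc i)) w∈descs
...   | k , k∈ , refl = suc (suc i ∸ k) , s≤s (m∸n≤m (suc i) k) ,
                        cong (desc (suc i)) (sym (m∸[m∸n]≡n (≤-pred (∈-upTo⁻ k∈))))

countA₁-raFactor : ∀ i p → countA₁ (raFactor i p) ≡ iverson (p ≤ᵇ 1)
countA₁-raFactor i zero          =
  trans (countA₁-++ (desc (suc i) i) _) (cong (_+ 1) (countA₁-desc-above (suc i) i ≤-refl))
countA₁-raFactor i (suc zero)    = countA₁-desc-full i
countA₁-raFactor i (suc (suc q)) = countA₁-desc-above (suc i) (i ∸ q) (s≤s (m∸n≤m i q))

raFactor₀-maxInserted : ∀ i → MaxInserted 0 (2 + i) (swapIfOdd i) ⟪ raFactor i 0 ⟫ʷ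
raFactor₀-maxInserted i = record
  { before = λ _ ()
  ; at     = trans (⟪⟫ʷ-++ (desc (suc i) i) _ 0) (at ins)
  ; after  = after′
  }
  where
  ins : MaxInserted 2 i (swapIfOdd i) ⟪ desc (suc i) i ⟫ʷ
  ins = desc-maxInserted i (suc i) 2 refl (s≤s z≤n)
  after′ : ∀ t → t < 2 + i → ⟪ raFactor i 0 ⟫ʷ (suc t) ≡ swapIfOdd i t
  after′ zero             _                 = trans (⟪⟫ʷ-++ (desc (suc i) i) _ 1) (before ins 0 (s≤s z≤n))
  after′ (suc zero)       _                 = trans (⟪⟫ʷ-++ (desc (suc i) i) _ 2) (before ins 1 (s≤s (s≤s z≤n)))
  after′ (suc (suc t))    (s≤s (s≤s t<i)) = trans (⟪⟫ʷ-++ (desc (suc i) i) _ (3 + t)) (after ins t t<i)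

raFactor-maxInserted : ∀ i p → p ≤ 2 + i →
  MaxInserted p (2 + i ∸ p) (swapIfOdd (2 + i ∸ p)) ⟪ raFactor i p ⟫ʷ
raFactor-maxInserted i zero    _           = raFactor₀-maxInserted i
raFactor-maxInserted i (suc q) (s≤s q≤1+i) =
  desc-maxInserted (suc i ∸ q) (suc i) (suc q) (sym (m+[n∸m]≡n (s≤s q≤1+i))) (s≤s z≤n)

raFactor-indicesBelow : ∀ i p → IndicesBelow (2 + i) (raFactor i p)
raFactor-indicesBelow i zero    = ++⁺ (desc-indicesBelow (suc i) i ≤-refl) (s≤s (s≤s z≤n) ∷ [])
raFactor-indicesBelow i (suc q) = desc-indicesBelow (suc i) _ ≤-refl

data RAWord : ℕ → List Letter → Set where
  []  : RAWord 0 []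
  _▷_ : ∀ {k w x} → RAWord k w → x ∈ RA (suc k) → RAWord (suc k) (w ++ x)

RAWord-indicesBelow : ∀ {k w} → RAWord k w → IndicesBelow (suc k) w
RAWord-indicesBelow []             = []
RAWord-indicesBelow (_▷_ {k} ws x∈) with ∈RA⇒raFactor k x∈
... | p , _ , refl = ++⁺ (All.map m<n⇒m<1+n (RAWord-indicesBelow ws)) (raFactor-indicesBelow k p)

module _ (φ : ℕ → ℕ → ℕ) (φ1≗φ0 : ∀ v → φ 1 v ≡ φ 0 v) where

  statistic-smaller-▷ : ∀ {k} w → IndicesBelow (suc k) w → ∀ p → p ≤ 2 + k →
    statistic smaller φ (3 + k) ⟪ w ++ raFactor k p ⟫ʷ ≡ statistic smaller φ (2 + k) ⟪ w ⟫ʷ + φ p (2 + k)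
  statistic-smaller-▷ {k} w w<1+k p p≤2+k = begin
    statistic smaller φ (3 + k) ⟪ w ++ raFactor k p ⟫ʷ        ≡⟨ statistic-cong smaller φ (3 + k) (λ x _ → ⟪⟫ʷ-++ w (raFactor k p) x) ⟩
    statistic smaller φ (3 + k) (⟪ w ⟫ʷ ∘ ⟪ raFactor k p ⟫ʷ)  ≡⟨ subst (λ m → statistic smaller φ (suc m) (⟪ w ⟫ʷ ∘ ⟪ raFactor k p ⟫ʷ)
                                                                      ≡ statistic smaller φ m (⟪ w ⟫ʷ ∘ swapIfOdd r) + φ p m)
                                                                  p+r≡2+k (statistic-smaller-insert ins bounded φ) ⟩
    statistic smaller φ (2 + k) (⟪ w ⟫ʷ ∘ swapIfOdd r) + φ p (2 + k)
      ≡⟨ cong (_+ φ p (2 + k)) (statistic-smaller-swapIfOdd φ φ1≗φ0 r k ⟪ w ⟫ʷ) ⟩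
    statistic smaller φ (2 + k) ⟪ w ⟫ʷ + φ p (2 + k)          ∎
    where
    r : ℕ
    r = 2 + k ∸ p
    p+r≡2+k : p + r ≡ 2 + k
    p+r≡2+k = m+[n∸m]≡n p≤2+k
    ins : MaxInserted p r (⟪ w ⟫ʷ ∘ swapIfOdd r) (⟪ w ⟫ʷ ∘ ⟪ raFactor k p ⟫ʷ)
    ins = maxInserted-∘ ⟪ w ⟫ʷ (raFactor-maxInserted k p p≤2+k)
            (⟪⟫ʷ-fixes w w<1+k (p + r) (subst (suc k <_) (sym p+r≡2+k) ≤-refl))
    bounded : Bounded (p + r) (⟪ w ⟫ʷ ∘ swapIfOdd r)
    bounded x x<p+r = subst (λ m → ⟪ w ⟫ʷ (swapIfOdd r x) < m) (sym p+r≡2+k)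
      (⟪⟫ʷ-bounded w w<1+k _ (swapIfOdd-bounded r (λ _ → s≤s (s≤s z≤n)) (subst (x <_) p+r≡2+k x<p+r)))

  statistic-smaller-RAWord : (∀ p k → φ p (2 + k) ≡ iverson (p ≤ᵇ 1)) → ∀ {k w} → RAWord k w →
    statistic smaller φ (2 + k) ⟪ w ⟫ʷ ≡ countA₁ w + statistic smaller φ 2 ⟪ [] ⟫ʷ
  statistic-smaller-RAWord φ-at-max []                     = refl
  statistic-smaller-RAWord φ-at-max (_▷_ {k} {w} ws x∈) with ∈RA⇒raFactor k x∈
  ... | p , p≤2+k , refl = begin
    statistic smaller φ (3 + k) ⟪ w ++ raFactor k p ⟫ʷ        ≡⟨ statistic-smaller-▷ w (RAWord-indicesBelow ws) p p≤2+k ⟩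
    statistic smaller φ (2 + k) ⟪ w ⟫ʷ + φ p (2 + k)          ≡⟨ cong₂ _+_ (statistic-smaller-RAWord φ-at-max ws) (φ-at-max p k) ⟩
    countA₁ w + c + iverson (p ≤ᵇ 1)                          ≡⟨ xy∙z≈xz∙y (countA₁ w) c _ ⟩
    countA₁ w + iverson (p ≤ᵇ 1) + c                          ≡⟨ cong (_+ c) (trans (countA₁-++ w _) (cong (countA₁ w +_) (countA₁-raFactor k p))) ⟨
    countA₁ (w ++ raFactor k p) + c                           ∎
    where
    c : ℕ
    c = statistic smaller φ 2 ⟪ [] ⟫ʷ

-- Existence of the factorization

record IsPermutationOn (m : ℕ) (V : ℕ → ℕ) : Set where
  field
    inverse         : ℕ → ℕ
    bounded         : Bounded m V
    inverse-bounded : Bounded m inverse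
    inverseˡ        : ∀ x → x < m → inverse (V x) ≡ x
    inverseʳ        : ∀ y → y < m → V (inverse y) ≡ y

  injective : ∀ {x y} → x < m → y < m → V x ≡ V y → x ≡ y
  injective {x} {y} x<m y<m Vx≡Vy = trans (sym (inverseˡ x x<m)) (trans (cong inverse Vx≡Vy) (inverseˡ y y<m))
open IsPermutationOn

∘-isPermutationOn : ∀ {m f g} → IsPermutationOn m f → IsPermutationOn m g → IsPermutationOn m (f ∘ g)
∘-isPermutationOn {f = f} {g} F G = record
  { inverse         = inverse G ∘ inverse F
  ; bounded         = λ x x<m → bounded F _ (bounded G x x<m)
  ; inverse-bounded = λ y y<m → inverse-bounded G _ (inverse-bounded F y y<m)
  ; inverseˡ        = λ x x<m → trans (cong (inverse G) (inverseˡ F _ (bounded G x x<m))) (inverseˡ G x x<m)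
  ; inverseʳ        = λ y y<m → trans (cong f (inverseʳ G _ (inverse-bounded F y y<m))) (inverseʳ F y y<m)
  }

swapIfOdd-isPermutationOn : ∀ {m} k → 2 ≤ m → IsPermutationOn m (swapIfOdd k)
swapIfOdd-isPermutationOn k 2≤m = record
  { inverse         = swapIfOdd k
  ; bounded         = λ x → swapIfOdd-bounded k (λ _ → 2≤m)
  ; inverse-bounded = λ x → swapIfOdd-bounded k (λ _ → 2≤m)
  ; inverseˡ        = λ x _ → swapIfOdd-involutive k x
  ; inverseʳ        = λ x _ → swapIfOdd-involutive k x
  }

skip : ℕ → ℕ → ℕ
skip zero    y       = suc y
skip (suc p) zero    = zero
skip (suc p) (suc y) = suc (skip p y)

unskip : ℕ → ℕ → ℕ
unskip zero    q       = pred q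
unskip (suc p) zero    = zero
unskip (suc p) (suc q) = suc (unskip p q)

skip-< : ∀ {p y} → y < p → skip p y ≡ y
skip-< {suc p} {zero}  _         = refl
skip-< {suc p} {suc y} (s≤s y<p) = cong suc (skip-< y<p)

skip-≥ : ∀ {p y} → p ≤ y → skip p y ≡ suc y
skip-≥ {zero}          _         = refl
skip-≥ {suc p} {suc y} (s≤s p≤y) = cong suc (skip-≥ p≤y)

skip-≢ : ∀ p y → skip p y ≢ p
skip-≢ (suc p) (suc y) eq = skip-≢ p y (suc-injective eq)

skip-bounded : ∀ p {m y} → y < m → skip p y < suc m
skip-bounded zero                    y<m       = s≤s y<m
skip-bounded (suc p) {y = zero}      _         = s≤s z≤n
skip-bounded (suc p) {suc m} {suc y} (s≤s y<m) = s≤s (skip-bounded p y<m)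

unskip-skip : ∀ p y → unskip p (skip p y) ≡ y
unskip-skip zero    y       = refl
unskip-skip (suc p) zero    = refl
unskip-skip (suc p) (suc y) = cong suc (unskip-skip p y)

skip-unskip : ∀ p q → q ≢ p → skip p (unskip p q) ≡ q
skip-unskip zero    zero    q≢p = contradiction refl q≢p
skip-unskip zero    (suc q) _   = refl
skip-unskip (suc p) zero    _   = refl
skip-unskip (suc p) (suc q) q≢p = cong suc (skip-unskip p q (q≢p ∘ cong suc))

unskip-bounded : ∀ p {m q} → q < suc m → q ≢ p → p ≤ m → unskip p q < m
unskip-bounded zero    {q = zero}  _         q≢p _   = contradiction refl q≢p
unskip-bounded zero    {q = suc q} (s≤s q<m) _   _   = q<m
unskip-bounded (suc p) {q = zero}  _         _   p<m = ≤-trans (s≤s z≤n) p<m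
unskip-bounded (suc p) {suc m} {suc q} (s≤s q<1+m) q≢p (s≤s p≤m) =
  s≤s (unskip-bounded p q<1+m (q≢p ∘ cong suc) p≤m)

module _ {m : ℕ} {V : ℕ → ℕ} (V-perm : IsPermutationOn (suc m) V) where
  private
    p : ℕ
    p = inverse V-perm m
    Vp≡m : V p ≡ m
    Vp≡m = inverseʳ V-perm m ≤-refl

  removeMax-isPermutationOn : IsPermutationOn m (V ∘ skip p)
  removeMax-isPermutationOn = record
    { inverse         = unskip p ∘ inverse V-perm
    ; bounded         = λ y y<m → ≤∧≢⇒< (≤-pred (bounded V-perm _ (skip-bounded p y<m))) (Vskip≢m y y<m)
    ; inverse-bounded = λ y y<m → unskip-bounded p (inverse-bounded V-perm y (m<n⇒m<1+n y<m))
                          (inverse≢p y y<m) (≤-pred (inverse-bounded V-perm m ≤-refl))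
    ; inverseˡ        = λ y y<m → trans (cong (unskip p) (inverseˡ V-perm _ (skip-bounded p y<m))) (unskip-skip p y)
    ; inverseʳ        = λ y y<m → trans (cong V (skip-unskip p _ (inverse≢p y y<m))) (inverseʳ V-perm y (m<n⇒m<1+n y<m))
    }
    where
    Vskip≢m : ∀ y → y < m → V (skip p y) ≢ m
    Vskip≢m y y<m eq = skip-≢ p y (injective V-perm (skip-bounded p y<m) (inverse-bounded V-perm m ≤-refl) (trans eq (sym Vp≡m)))
    inverse≢p : ∀ y → y < m → inverse V-perm y ≢ p
    inverse≢p y y<m eq = <⇒≢ y<m (trans (sym (inverseʳ V-perm y (m<n⇒m<1+n y<m))) (trans (cong V eq) Vp≡m))

  p+[m∸p]≡m : p + (m ∸ p) ≡ m
  p+[m∸p]≡m = m+[n∸m]≡n (≤-pred (inverse-bounded V-perm m ≤-refl))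

  removeMax-maxInserted : MaxInserted p (m ∸ p) (V ∘ skip p) V
  removeMax-maxInserted = record
    { before = λ x x<p → cong V (sym (skip-< x<p))
    ; at     = trans Vp≡m (sym p+[m∸p]≡m)
    ; after  = λ t _ → cong V (sym (skip-≥ (m≤m+n p t)))
    }

  inversionCount-removeMax : inversionCount (suc m) V ≡ inversionCount m (V ∘ skip p) + (m ∸ p)
  inversionCount-removeMax =
    subst (λ n → inversionCount (suc n) V ≡ inversionCount n (V ∘ skip p) + (m ∸ p)) p+[m∸p]≡m
      (inversionCount-insert removeMax-maxInserted
        (subst (λ n → Bounded n (V ∘ skip p)) (sym p+[m∸p]≡m) (bounded removeMax-isPermutationOn)))

even-permutation₂ : ∀ {V} → IsPermutationOn 2 V → parity (inversionCount 2 V) ≡ false →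
  ∀ x → x < 2 → ⟪ [] ⟫ʷ x ≡ V x
even-permutation₂ {V} V-perm even
  with V 0 in eq₀ | V 1 in eq₁ | bounded V-perm 0 (s≤s z≤n) | bounded V-perm 1 (s≤s (s≤s z≤n))
... | zero     | suc zero | _ | _ = λ { zero _ → sym eq₀ ; (suc zero) _ → sym eq₁ ; (suc (suc _)) (s≤s (s≤s ())) }
... | zero     | zero     | _ | _ = contradiction (injective V-perm (s≤s z≤n) (s≤s (s≤s z≤n)) (trans eq₀ (sym eq₁))) λ ()
... | suc zero | suc zero | _ | _ = contradiction (injective V-perm (s≤s z≤n) (s≤s (s≤s z≤n)) (trans eq₀ (sym eq₁))) λ ()
... | suc zero | zero     | _ | _ = contradiction even λ ()
... | suc (suc _) | _ | s≤s (s≤s ()) | _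
... | _ | suc (suc _) | _ | s≤s (s≤s ())

-- The recursion of statistic-smaller-RAWord run backwards: remove the maximum, sitting at
-- position p, restore evenness by swapIfOdd (m ∸ p), and put it back with raFactor k p.
RAWord-exists : ∀ k {V} → IsPermutationOn (2 + k) V → parity (inversionCount (2 + k) V) ≡ false →
  Σ (List Letter) λ w → RAWord k w × (∀ x → x < 2 + k → ⟪ w ⟫ʷ x ≡ V x)
RAWord-exists zero    V-perm even = [] , [] , even-permutation₂ V-perm even
RAWord-exists (suc k) {V} V-perm even = extend (RAWord-exists k U-perm U-even)
  where
  m p r : ℕ
  m = 2 + k
  p = inverse V-perm m
  r = m ∸ p
  p≤m : p ≤ m
  p≤m = ≤-pred (inverse-bounded V-perm m ≤-refl)
  U′-perm : IsPermutationOn m (V ∘ skip p)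
  U′-perm = removeMax-isPermutationOn V-perm
  U-perm : IsPermutationOn m (V ∘ skip p ∘ swapIfOdd r)
  U-perm = ∘-isPermutationOn U′-perm (swapIfOdd-isPermutationOn r (s≤s (s≤s z≤n)))

  U-even : parity (inversionCount m (V ∘ skip p ∘ swapIfOdd r)) ≡ false
  U-even = begin
    parity (inversionCount m (V ∘ skip p ∘ swapIfOdd r))  ≡⟨ inversionCount-swapIfOdd r k (V ∘ skip p) U′0≢U′1 ⟩
    parity (inversionCount m (V ∘ skip p) + r)             ≡⟨ cong parity (inversionCount-removeMax V-perm) ⟨
    parity (inversionCount (suc m) V)                      ≡⟨ even ⟩
    false                                                  ∎
    where
    U′0≢U′1 : V (skip p 0) ≢ V (skip p 1)
    U′0≢U′1 eq = contradiction (injective U′-perm (s≤s z≤n) (s≤s (s≤s z≤n)) eq) λ ()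

  extend : Σ (List Letter) (λ w → RAWord k w × (∀ x → x < m → ⟪ w ⟫ʷ x ≡ V (skip p (swapIfOdd r x)))) →
           Σ (List Letter) (λ w → RAWord (suc k) w × (∀ x → x < suc m → ⟪ w ⟫ʷ x ≡ V x))
  extend (w , ws , w≗U) = w ++ raFactor k p , ws ▷ raFactor-∈RA k p , agree
    where
    p+r≡m : p + r ≡ m
    p+r≡m = p+[m∸p]≡m V-perm
    ins : MaxInserted p r (⟪ w ⟫ʷ ∘ swapIfOdd r) (⟪ w ⟫ʷ ∘ ⟪ raFactor k p ⟫ʷ)
    ins = maxInserted-∘ ⟪ w ⟫ʷ (raFactor-maxInserted k p p≤m)
            (⟪⟫ʷ-fixes w (RAWord-indicesBelow ws) (p + r) (subst (suc k <_) (sym p+r≡m) ≤-refl))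
    w-unswapped : ∀ x → x < p + r → ⟪ w ⟫ʷ (swapIfOdd r x) ≡ V (skip p x)
    w-unswapped x x<p+r = trans (w≗U _ (swapIfOdd-bounded r (λ _ → s≤s (s≤s z≤n)) (subst (x <_) p+r≡m x<p+r)))
                                (cong (V ∘ skip p) (swapIfOdd-involutive r x))
    agree : ∀ x → x < suc m → ⟪ w ++ raFactor k p ⟫ʷ x ≡ V x
    agree x x<1+m = trans (⟪⟫ʷ-++ w (raFactor k p) x)
      (maxInserted-unique ins (removeMax-maxInserted V-perm) w-unswapped x (subst (λ n → x < suc n) (sym p+r≡m) x<1+m))

-- Permutations of Fin m

transpose-swapAdj : ∀ {m} (i j k : Fin m) → toℕ j ≡ suc (toℕ i) →
  toℕ (PC.transpose i j k) ≡ swapAdj (toℕ i) (toℕ k)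
transpose-swapAdj i j k j≡1+i with k Fin.≟ i
... | yes refl = trans j≡1+i (sym (swapAdj-self (toℕ k)))
... | no k≢i with k Fin.≟ j
...   | yes refl = sym (trans (cong (swapAdj (toℕ i)) j≡1+i) (swapAdj-suc (toℕ i)))
...   | no k≢j = sym (swapAdj-≢ (toℕ i) (toℕ k) (k≢i ∘ toℕ-injective) (k≢j ∘ toℕ-injective ∘ (λ e → trans e (sym j≡1+i))))

s-swapAdj : ∀ n p → p < n → ∀ (x : Fin (suc n)) → toℕ (s n (suc p) ⟨$⟩ʳ x) ≡ swapAdj p (toℕ x)
s-swapAdj n p p<n x with suc p <? suc n
... | yes p+1<1+n = trans (transpose-swapAdj _ _ x (trans (toℕ-fromℕ< p+1<1+n) (cong suc (sym (toℕ-fromℕ< _)))))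
                          (cong (λ i → swapAdj i (toℕ x)) (toℕ-fromℕ< {m = p} {n = suc n} _))
... | no p+1≮1+n  = contradiction (s≤s p<n) p+1≮1+n

⟦⟧ₗ-⟪⟫ₗ : ∀ n l → index l < n → ∀ (x : Fin (suc n)) → toℕ (⟦_⟧ₗ {n} l ⟨$⟩ʳ x) ≡ ⟪ l ⟫ₗ (toℕ x)
⟦⟧ₗ-⟪⟫ₗ n (letter i false) i<n x = trans (s-swapAdj n 0 (≤-trans (s≤s z≤n) i<n) _) (cong swap01 (s-swapAdj n i i<n x))
⟦⟧ₗ-⟪⟫ₗ n (letter i true)  i<n x = trans (s-swapAdj n i i<n _) (cong (swapAdj i) (s-swapAdj n 0 (≤-trans (s≤s z≤n) i<n) x))

⟦⟧ʷ-⟪⟫ʷ : ∀ n w → IndicesBelow n w → ∀ (x : Fin (suc n)) → toℕ (⟦_⟧ʷ {n} w ⟨$⟩ʳ x) ≡ ⟪ w ⟫ʷ (toℕ x)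
⟦⟧ʷ-⟪⟫ʷ n []      []           x = refl
⟦⟧ʷ-⟪⟫ʷ n (l ∷ w) (l<n ∷ w<n) x = trans (⟦⟧ₗ-⟪⟫ₗ n l l<n _) (cong ⟪ l ⟫ₗ (⟦⟧ʷ-⟪⟫ʷ n w w<n x))

sumFin-∑< : ∀ m (f : Fin m → ℕ) (g : ℕ → ℕ) → (∀ i → f i ≡ g (toℕ i)) → FinSum.sum f ≡ ∑< m g
sumFin-∑< zero    f g f≗g = refl
sumFin-∑< (suc m) f g f≗g = cong₂ _+_ (f≗g Fin.zero) (sumFin-∑< m (f ∘ Fin.suc) (g ∘ suc) (f≗g ∘ Fin.suc))

length-filterᵇ-tabulate : ∀ {A : Set} m (f : Fin m → A) (P : A → Bool) →
  length (filterᵇ P (List.tabulate f)) ≡ FinSum.sum (iverson ∘ P ∘ f)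
length-filterᵇ-tabulate zero    f P = refl
length-filterᵇ-tabulate (suc m) f P with P (f Fin.zero)
... | true  = cong suc (length-filterᵇ-tabulate m (f ∘ Fin.suc) P)
... | false = length-filterᵇ-tabulate m (f ∘ Fin.suc) P

sum-tabulate : ∀ m (f : Fin m → ℕ) → sum (List.tabulate f) ≡ FinSum.sum f
sum-tabulate zero    f = refl
sum-tabulate (suc m) f = cong (f Fin.zero +_) (sum-tabulate m (f ∘ Fin.suc))

∣subsetOf∣ : ∀ m (P : Fin m → Bool) → ∣ subsetOf P ∣ ≡ countFin P
∣subsetOf∣ m P = trans (card m P) (sym (length-filterᵇ-tabulate m (λ i → i) P))
  where
  card : ∀ m (P : Fin m → Bool) → ∣ subsetOf P ∣ ≡ FinSum.sum (iverson ∘ P)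
  card zero    P = refl
  card (suc m) P with P Fin.zero
  ... | true  = cong suc (card m (P ∘ Fin.suc))
  ... | false = card m (P ∘ Fin.suc)

module _ {m : ℕ} where

  countFin-∑< : ∀ (P : Fin m → Bool) (Q : ℕ → Bool) → (∀ i → P i ≡ Q (toℕ i)) → countFin P ≡ ∑[ x < m ] iverson (Q x)
  countFin-∑< P Q P≗Q = trans (length-filterᵇ-tabulate m (λ i → i) P) (sumFin-∑< m _ _ (cong iverson ∘ P≗Q))

  countFin-cong : ∀ {P Q : Fin m → Bool} → (∀ i → P i ≡ Q i) → countFin P ≡ countFin Q
  countFin-cong {P} {Q} P≗Q = begin
    countFin P                   ≡⟨ length-filterᵇ-tabulate m (λ i → i) P ⟩
    FinSum.sum (iverson ∘ P)     ≡⟨ FinSum.sum-cong-≗ (cong iverson ∘ P≗Q) ⟩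
    FinSum.sum (iverson ∘ Q)     ≡⟨ length-filterᵇ-tabulate m (λ i → i) Q ⟨
    countFin Q                   ∎

  countFin-permute : ∀ (P : Fin m → Bool) (π : Permutation′ m) → countFin P ≡ countFin (P ∘ (π ⟨$⟩ʳ_))
  countFin-permute P π = begin
    countFin P                           ≡⟨ length-filterᵇ-tabulate m (λ i → i) P ⟩
    FinSum.sum (iverson ∘ P)             ≡⟨ FinSum.sum-permute (iverson ∘ P) π ⟩
    FinSum.sum (iverson ∘ P ∘ (π ⟨$⟩ʳ_)) ≡⟨ length-filterᵇ-tabulate m (λ i → i) (P ∘ (π ⟨$⟩ʳ_)) ⟨
    countFin (P ∘ (π ⟨$⟩ʳ_))             ∎

module _ {M : ℕ} (u : Permutation′ M) (g : ℕ → ℕ) (u≗g : ∀ i → toℕ (u ⟨$⟩ʳ i) ≡ g (toℕ i)) where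

  private
    u<ᵇ≡g<ᵇ : ∀ j i → ⌊ toℕ (u ⟨$⟩ʳ j) <? toℕ (u ⟨$⟩ʳ i) ⌋ ≡ (g (toℕ j) <ᵇ g (toℕ i))
    u<ᵇ≡g<ᵇ j i = trans (⌊<?⌋ _ _) (cong₂ _<ᵇ_ (u≗g j) (u≗g i))

  smallerBefore-countBefore : ∀ i → smallerBefore u i ≡ countBefore smaller g (toℕ i)
  smallerBefore-countBefore i = begin
    smallerBefore u i
      ≡⟨ countFin-∑< _ (λ y → (y <ᵇ suc x) ∧ (g y <ᵇ g x))
           (λ j → cong₂ _∧_ (trans (⌊≤?⌋ (toℕ j) x) (≤ᵇ-<ᵇ-suc (toℕ j) x)) (u<ᵇ≡g<ᵇ j i)) ⟩
    ∑[ y < M ] iverson ((y <ᵇ suc x) ∧ (g y <ᵇ g x))  ≡⟨ ∑-below M (suc x) (λ y → g y <ᵇ g x) (toℕ<n i) ⟩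
    ∑[ y < suc x ] iverson (g y <ᵇ g x)               ≡⟨ ∑-last x _ ⟩
    countBefore smaller g x + iverson (g x <ᵇ g x)     ≡⟨ cong (λ b → countBefore smaller g x + iverson b) (<ᵇ-false (n≮n (g x))) ⟩
    countBefore smaller g x + 0                        ≡⟨ +-identityʳ _ ⟩
    countBefore smaller g x                            ∎
    where x = toℕ i

  alrmCount-a : alrmCount conv-a u ≡ alrmCountᵃ M g
  alrmCount-a = countFin-∑< (isALRM conv-a u) _ λ i →
    cong₂ _∧_ (trans (⌊≤?⌋ (smallerBefore u i) 1) (cong (_≤ᵇ 1) (smallerBefore-countBefore i))) (⌊≤?⌋ 2 (toℕ i))

  alrmCount-b : alrmCount conv-b u ≡ statistic smaller fewSmallerᵇ M g
  alrmCount-b = countFin-∑< (isALRM conv-b u) _ λ i →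
    cong₂ _∧_ (trans (⌊≤?⌋ (smallerBefore u i) 1) (cong (_≤ᵇ 1) (smallerBefore-countBefore i)))
              (trans (⌊≤?⌋ 2 (toℕ (u ⟨$⟩ʳ i))) (cong (2 ≤ᵇ_) (u≗g i)))

  inversions-inversionCount : inversions u ≡ inversionCount M g
  inversions-inversionCount = begin
    inversions u                                                  ≡⟨ cong sum (map-tabulate (λ i → i) F) ⟩
    sum (List.tabulate F)                                         ≡⟨ sum-tabulate M F ⟩
    FinSum.sum F                                                  ≡⟨ sumFin-∑< M F _ (λ i → countFin-∑< _ _ (λ j →
                                                                       cong₂ _∧_ (⌊<?⌋ _ _) (u<ᵇ≡g<ᵇ j i))) ⟩
    ∑[ x < M ] ∑[ y < M ] iverson ((x <ᵇ y) ∧ (g y <ᵇ g x))     ≡⟨ ∑-comm M M _ ⟩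
    ∑[ y < M ] ∑[ x < M ] iverson ((x <ᵇ y) ∧ (g y <ᵇ g x))     ≡⟨ ∑-cong M (λ y y<M → ∑-below M y _ (<⇒≤ y<M)) ⟩
    inversionCount M g                                            ∎
    where
    F : Fin M → ℕ
    F i = countFin (λ j → ⌊ toℕ i <? toℕ j ⌋ ∧ ⌊ toℕ (u ⟨$⟩ʳ j) <? toℕ (u ⟨$⟩ʳ i) ⌋)

≤ᵇ∧<ᵇ-comm : ∀ {a b c d} → (a ≡ b → c ≡ d) → (c ≡ d → a ≡ b) → (a ≤ᵇ b) ∧ (c <ᵇ d) ≡ (c ≤ᵇ d) ∧ (a <ᵇ b)
≤ᵇ∧<ᵇ-comm {a} {b} {c} {d} a≡b⇒c≡d c≡d⇒a≡b with <-cmp c d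
... | tri< c<d c≢d _ rewrite <ᵇ-true c<d | ≤ᵇ-true (<⇒≤ c<d) = trans (∧-identityʳ _) (≤ᵇ-<ᵇ-≢ (c≢d ∘ a≡b⇒c≡d))
... | tri> _ _ d<c   rewrite <ᵇ-false (<⇒≯ d<c) | ≤ᵇ-false (<⇒≱ d<c) = ∧-zeroʳ _
... | tri≈ _ refl _ with c≡d⇒a≡b refl
...   | refl rewrite <ᵇ-false (n≮n a) | <ᵇ-false (n≮n c) = trans (∧-zeroʳ _) (sym (∧-zeroʳ _))

smallerBefore-flip : ∀ {M} (u : Permutation′ M) i → smallerBefore (flip u) (u ⟨$⟩ʳ i) ≡ smallerBefore u i
smallerBefore-flip u i = trans (countFin-permute _ u) (countFin-cong same-condition)
  where
  same-condition : ∀ k → ⌊ toℕ (u ⟨$⟩ʳ k) ≤? toℕ (u ⟨$⟩ʳ i) ⌋ ∧ ⌊ toℕ (u ⟨$⟩ˡ (u ⟨$⟩ʳ k)) <? toℕ (u ⟨$⟩ˡ (u ⟨$⟩ʳ i)) ⌋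
                       ≡ ⌊ toℕ k ≤? toℕ i ⌋ ∧ ⌊ toℕ (u ⟨$⟩ʳ k) <? toℕ (u ⟨$⟩ʳ i) ⌋
  same-condition k rewrite Perm.inverseˡ u {k} | Perm.inverseˡ u {i}
                         | ⌊≤?⌋ (toℕ (u ⟨$⟩ʳ k)) (toℕ (u ⟨$⟩ʳ i)) | ⌊<?⌋ (toℕ k) (toℕ i)
                         | ⌊≤?⌋ (toℕ k) (toℕ i) | ⌊<?⌋ (toℕ (u ⟨$⟩ʳ k)) (toℕ (u ⟨$⟩ʳ i)) =
    ≤ᵇ∧<ᵇ-comm (cong toℕ ∘ u-injective ∘ toℕ-injective) (cong (toℕ ∘ (u ⟨$⟩ʳ_)) ∘ toℕ-injective)
    where
    u-injective : u ⟨$⟩ʳ k ≡ u ⟨$⟩ʳ i → k ≡ i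
    u-injective eq = trans (sym (Perm.inverseˡ u)) (trans (cong (u ⟨$⟩ˡ_) eq) (Perm.inverseˡ u))

alrmCount-flip : ∀ {M} (u : Permutation′ M) → alrmCount conv-a (flip u) ≡ alrmCount conv-b u
alrmCount-flip u = trans (countFin-permute _ u) (countFin-cong λ i →
  cong (λ n → ⌊ n ≤? 1 ⌋ ∧ ⌊ 2 ≤? toℕ (u ⟨$⟩ʳ i) ⌋) (smallerBefore-flip u i))

onℕ : ∀ {m} → (Fin m → Fin m) → ℕ → ℕ
onℕ {m} f x with x <? m
... | yes x<m = toℕ (f (fromℕ< x<m))
... | no  _   = x

onℕ-toℕ : ∀ {m} (f : Fin m → Fin m) i → onℕ f (toℕ i) ≡ toℕ (f i)
onℕ-toℕ {m} f i with toℕ i <? m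
... | yes i<m = cong (toℕ ∘ f) (fromℕ<-toℕ i i<m)
... | no  i≮m = contradiction (toℕ<n i) i≮m

∀-toℕ⇒∀-< : ∀ {m} (P : ℕ → Set) → (∀ (i : Fin m) → P (toℕ i)) → ∀ x → x < m → P x
∀-toℕ⇒∀-< P P-toℕ x x<m = subst P (toℕ-fromℕ< x<m) (P-toℕ (fromℕ< x<m))

onℕ-isPermutationOn : ∀ {m} (v : Permutation′ m) → IsPermutationOn m (onℕ (v ⟨$⟩ʳ_))
onℕ-isPermutationOn {m} v = record
  { inverse         = onℕ (v ⟨$⟩ˡ_)
  ; bounded         = ∀-toℕ⇒∀-< _ (λ i → subst (_< m) (sym (onℕ-toℕ _ i)) (toℕ<n _))
  ; inverse-bounded = ∀-toℕ⇒∀-< _ (λ i → subst (_< m) (sym (onℕ-toℕ _ i)) (toℕ<n _))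
  ; inverseˡ        = ∀-toℕ⇒∀-< _ (λ i → trans (cong (onℕ (v ⟨$⟩ˡ_)) (onℕ-toℕ _ i))
                                        (trans (onℕ-toℕ _ (v ⟨$⟩ʳ i)) (cong toℕ (Perm.inverseˡ v))))
  ; inverseʳ        = ∀-toℕ⇒∀-< _ (λ i → trans (cong (onℕ (v ⟨$⟩ʳ_)) (onℕ-toℕ _ i))
                                        (trans (onℕ-toℕ _ (v ⟨$⟩ˡ i)) (cong toℕ (Perm.inverseʳ v))))
  }

-- Factorizations

module _ {A : Set} where

  lookup-∷ʳ⁺ : ∀ {k} (P : ℕ → A → Set) (xs : Vec A k) x → (∀ t → P (toℕ t) (lookup xs t)) → P k x →
    ∀ t → P (toℕ t) (lookup (xs ∷ʳ x) t)
  lookup-∷ʳ⁺ P []       x _      Px Fin.zero    = Px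
  lookup-∷ʳ⁺ P (y ∷ ys) x P-init Px Fin.zero    = P-init Fin.zero
  lookup-∷ʳ⁺ P (y ∷ ys) x P-init Px (Fin.suc t) = lookup-∷ʳ⁺ (P ∘ suc) ys x (P-init ∘ Fin.suc) Px t

  lookup-∷ʳ⁻ : ∀ {k} (P : ℕ → A → Set) (xs : Vec A k) x → (∀ t → P (toℕ t) (lookup (xs ∷ʳ x) t)) →
    (∀ t → P (toℕ t) (lookup xs t)) × P k x
  lookup-∷ʳ⁻ P []       x P-all = (λ ()) , P-all Fin.zero
  lookup-∷ʳ⁻ P (y ∷ ys) x P-all with lookup-∷ʳ⁻ (P ∘ suc) ys x (P-all ∘ Fin.suc)
  ... | P-init , Px = (λ { Fin.zero → P-all Fin.zero ; (Fin.suc t) → P-init t }) , Px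

concat-toList-∷ʳ : ∀ {A : Set} {k} (xss : Vec (List A) k) xs →
  List.concat (toList (xss ∷ʳ xs)) ≡ List.concat (toList xss) ++ xs
concat-toList-∷ʳ []         xs = ++-identityʳ xs
concat-toList-∷ʳ (ys ∷ yss) xs = trans (cong (ys ++_) (concat-toList-∷ʳ yss xs)) (sym (++-assoc ys _ xs))

AreRAFactors : ∀ {k} → Vec (List Letter) k → Set
AreRAFactors fs = ∀ t → lookup fs t ∈ RA (suc (toℕ t))

areRAFactors⇒RAWord : ∀ {k} (fs : Vec (List Letter) k) → AreRAFactors fs → RAWord k (List.concat (toList fs))
areRAFactors⇒RAWord {zero}  []  _       = []
areRAFactors⇒RAWord {suc k} fs  fs∈RA with initLast fs
... | ys , y , refl with lookup-∷ʳ⁻ (λ t x → x ∈ RA (suc t)) ys y fs∈RA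
...   | ys∈RA , y∈RA = subst (RAWord (suc k)) (sym (concat-toList-∷ʳ ys y)) (areRAFactors⇒RAWord ys ys∈RA ▷ y∈RA)

RAWord⇒areRAFactors : ∀ {k w} → RAWord k w →
  Σ (Vec (List Letter) k) λ fs → AreRAFactors fs × List.concat (toList fs) ≡ w
RAWord⇒areRAFactors []        = [] , (λ ()) , refl
RAWord⇒areRAFactors (_▷_ {x = x} ws x∈RA) with RAWord⇒areRAFactors ws
... | fs , fs∈RA , fs≡w =
  fs ∷ʳ x , lookup-∷ʳ⁺ (λ t x → x ∈ RA (suc t)) fs x fs∈RA x∈RA , trans (concat-toList-∷ʳ fs x) (cong (_++ x) fs≡w)

factorization-RAWord : ∀ {k} (f : Factorization (2 + k)) → RAWord (suc k) (word f)
factorization-RAWord f = areRAFactors⇒RAWord (factors f) (inRA f)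

delA≡alrmCount : ∀ {k} (f : Factorization (2 + k)) (u : Permutation′ (3 + k)) → eval f ≈ u →
  ∀ c → delA f ≡ alrmCount c u
delA≡alrmCount {k} f u f≈u c = by-convention c
  where
  ws : RAWord (suc k) (word f)
  ws = factorization-RAWord f
  u≗w : ∀ i → toℕ (u ⟨$⟩ʳ i) ≡ ⟪ word f ⟫ʷ (toℕ i)
  u≗w i = trans (cong toℕ (sym (f≈u i))) (⟦⟧ʷ-⟪⟫ʷ (2 + k) (word f) (RAWord-indicesBelow ws) i)
  by-convention : ∀ c → delA f ≡ alrmCount c u
  by-convention conv-a = sym (+-cancelʳ-≡ 2 _ _ (begin
    alrmCount conv-a u + 2                              ≡⟨ cong (_+ 2) (alrmCount-a u ⟪ word f ⟫ʷ u≗w) ⟩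
    alrmCountᵃ (3 + k) ⟪ word f ⟫ʷ + 2                 ≡⟨ alrmCountᵃ-fewSmaller (suc k) ⟪ word f ⟫ʷ ⟩
    statistic smaller fewSmaller (3 + k) ⟪ word f ⟫ʷ   ≡⟨ statistic-smaller-RAWord fewSmaller (λ _ → refl) (λ _ _ → refl) ws ⟩
    delA f + 2                                          ∎))
  by-convention conv-b = sym (begin
    alrmCount conv-b u                                   ≡⟨ alrmCount-b u ⟪ word f ⟫ʷ u≗w ⟩
    statistic smaller fewSmallerᵇ (3 + k) ⟪ word f ⟫ʷ   ≡⟨ statistic-smaller-RAWord fewSmallerᵇ (λ _ → refl)
                                                              (λ p _ → cong iverson (∧-identityʳ (p ≤ᵇ 1))) ws ⟩
    delA f + 0                                           ≡⟨ +-identityʳ _ ⟩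
    delA f                                               ∎)

factorization-exists : ∀ {k} (v : Permutation′ (3 + k)) → IsEven v → Σ (Factorization (2 + k)) (λ f → eval f ≈ v)
factorization-exists {k} v v-even = realise (RAWord-exists (suc k) (onℕ-isPermutationOn v) V-even)
  where
  V : ℕ → ℕ
  V = onℕ (v ⟨$⟩ʳ_)
  V-even : parity (inversionCount (3 + k) V) ≡ false
  V-even = %2≡0⇒parity≡false (inversionCount (3 + k) V)
    (subst (λ n → n % 2 ≡ 0) (inversions-inversionCount v V (sym ∘ onℕ-toℕ _)) v-even)
  realise : Σ (List Letter) (λ w → RAWord (suc k) w × (∀ x → x < 3 + k → ⟪ w ⟫ʷ x ≡ V x)) →
            Σ (Factorization (2 + k)) (λ f → eval f ≈ v)
  realise (w , ws , w≗V) with RAWord⇒areRAFactors ws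
  ... | fs , fs∈RA , refl = factorization fs fs∈RA , λ i → toℕ-injective (begin
    toℕ (⟦ List.concat (toList fs) ⟧ʷ ⟨$⟩ʳ i)   ≡⟨ ⟦⟧ʷ-⟪⟫ʷ (2 + k) _ (RAWord-indicesBelow ws) i ⟩
    ⟪ List.concat (toList fs) ⟫ʷ (toℕ i)        ≡⟨ w≗V (toℕ i) (toℕ<n i) ⟩
    V (toℕ i)                                   ≡⟨ onℕ-toℕ _ i ⟩
    toℕ (v ⟨$⟩ʳ i)                              ∎)

proposition7p7 : (n : ℕ) → 2 ≤ n → (v : Permutation′ (suc n)) → IsEven v →
    Σ (Factorization n) (λ f → eval f ≈ v)
    × ((f : Factorization n) → eval f ≈ v →
        ((c : Convention) → delA f ≡ alrmCount c (flip v))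
        × (∣ DelA v ∣ ≡ delA f)
        × ((g : Factorization n) → eval g ≈ flip v → delA f ≡ delA g))
proposition7p7 (suc (suc k)) (s≤s (s≤s z≤n)) v v-even = factorization-exists v v-even , properties
  where
  properties : (f : Factorization (2 + k)) → eval f ≈ v →
    ((c : Convention) → delA f ≡ alrmCount c (flip v))
    × (∣ DelA v ∣ ≡ delA f)
    × ((g : Factorization (2 + k)) → eval g ≈ flip v → delA f ≡ delA g)
  properties f f≈v = delA≡alrmCount-flip , ∣DelA∣≡delA , delA-flip
    where
    delA≡alrmCount-flip : ∀ c → delA f ≡ alrmCount c (flip v)
    delA≡alrmCount-flip conv-a = trans (delA≡alrmCount f v f≈v conv-b) (sym (alrmCount-flip v))
    delA≡alrmCount-flip conv-b = trans (delA≡alrmCount f v f≈v conv-a) (alrmCount-flip (flip v))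
    ∣DelA∣≡delA : ∣ DelA v ∣ ≡ delA f
    ∣DelA∣≡delA = trans (∣subsetOf∣ _ (isALRM conv-a v)) (sym (delA≡alrmCount f v f≈v conv-a))
    delA-flip : (g : Factorization (2 + k)) → eval g ≈ flip v → delA f ≡ delA g
    delA-flip g g≈v⁻¹ = trans (delA≡alrmCount-flip conv-a) (sym (delA≡alrmCount g (flip v) g≈v⁻¹ conv-a))
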